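{- For any positive integers $n,k$ with $k<\frac{n}{2}$, $$\mathrm{Det}(K(n,k))\geq \frac{2n-2}{k+1}.$$
   Context: For positive integers $n,k$, the Kneser graph $K(n,k)$ has as vertices the $k$-element subsets of $[n]=\{1,\ldots,n\}$, two vertices being adjacent iff the subsets are disjoint. For a graph $G=(V,E)$, the determining number $\mathrm{Det}(G)$ is the minimum cardinality of a set $S\subseteq V$ such that the only automorphism of $G$ fixing every vertex of $S$ is the identity. -}

module Defs where

open import Data.Nat using (ℕ)
open import Data.Fin.Subset using (Subset; ∣_∣; _∩_; Empty)
open import Data.Product using (Σ; proj₁; _×_)
open import Data.List using (List)
open import Data.List.Membership.Propositional using (_∈_)
open import Relation.Binary.PropositionalEquality using (_≡_)
open import Function.Bundles using (_⇔_)

KVertex : ℕ → ℕ → Set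
KVertex n k = Σ (Subset n) (λ s → ∣ s ∣ ≡ k)

KAdj : ∀ {n k} → KVertex n k → KVertex n k → Set
KAdj u v = Empty (proj₁ u ∩ proj₁ v)

_≈V_ : ∀ {n k} → KVertex n k → KVertex n k → Set
u ≈V v = proj₁ u ≡ proj₁ v

record KAut (n k : ℕ) : Set where
  field
    to      : KVertex n k → KVertex n k
    from    : KVertex n k → KVertex n k
    to-from : ∀ v → to (from v) ≈V v
    from-to : ∀ v → from (to v) ≈V v
    adj     : ∀ u v → KAdj u v ⇔ KAdj (to u) (to v)

Determining : ∀ {n k} → List (KVertex n k) → Set
Determining {n} {k} S =
  (σ : KAut n k) → (∀ v → v ∈ S → KAut.to σ v ≈V v) → ∀ v → KAut.to σ v ≈V v

-- If two points i ≠ j of [n] lie in exactly the same sets of a determining set S, the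
-- automorphism induced by the transposition (i j) fixes S pointwise, yet moves a k-set
-- that separates i from j.  So the n incidence vectors ("columns") of S in {0,1}^|S| are
-- pairwise distinct, while their total weight is |S| k.  Distinct words are heavy: n of
-- them in {0,1}^m have total weight at least 2n - m - 2, hence 2n - 2 ≤ (k + 1) |S|.
module Submission where

open import Defs
open import Data.Nat.Properties hiding (_≟_)
open import Algebra.Properties.CommutativeMonoid.Sum +-0-commutativeMonoid
  using (sum-syntax; sum-cong-≗; sum-replicate-zero; ∑-distrib-+; sum-permute)
  renaming (sum to ∑)
open import Data.Bool using (Bool; true; false)
import Data.Bool as Bool
open import Data.Fin using (Fin; zero; suc; _≟_)
open import Data.Fin.Permutation using (Permutation′; _⟨$⟩ʳ_; flip; inverseʳ; transpose)
open import Data.Fin.Subset using (Subset; ∣_∣; _∩_; Empty; _∈_; ⊥)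
open import Data.Fin.Subset.Properties using (x∈p∩q⁺; x∈p∩q⁻; ∣⊥∣≡0)
open import Data.List using (List; []; _∷_; length; map; tabulate)
open import Data.List.Membership.Propositional using () renaming (_∈_ to _∈ₗ_)
open import Data.List.Properties using (length-tabulate)
open import Data.List.Relation.Unary.All using (All; []; _∷_)
open import Data.List.Relation.Unary.AllPairs using ([]; _∷_)
open import Data.List.Relation.Unary.Any using (here; there)
open import Data.List.Relation.Unary.Unique.Propositional using (Unique)
open import Data.List.Relation.Unary.Unique.Propositional.Properties using (tabulate⁺)
open import Data.Nat using (ℕ; zero; suc; _+_; _*_; _∸_; _≤_; _<_; z≤n; s≤s)
open import Data.Nat.ListAction using (sum)
open import Data.Nat.Tactic.RingSolver using (solve-∀)
open import Data.Product using (Σ; ∃; _,_; proj₁)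
open import Data.Vec using (_∷_; []; lookup)
import Data.Vec as Vec
open import Data.Vec.Properties using (lookup∘tabulate; tabulate∘lookup; tabulate-cong; ∷-injectiveˡ; ∷-injectiveʳ; []=⇒lookup; lookup⇒[]=; ≡-dec)
open import Function using (_∘_)
open import Function.Bundles using (mk⇔)
open import Relation.Binary.PropositionalEquality
open import Relation.Nullary using (yes; no; contradiction)

indicator : Bool → ℕ
indicator true  = 1
indicator false = 0

∣∷∣ : ∀ {m} b (p : Subset m) → ∣ b ∷ p ∣ ≡ indicator b + ∣ p ∣
∣∷∣ true  p = refl
∣∷∣ false p = refl

∣p∣≡∑indicator : ∀ {n} (p : Subset n) → ∣ p ∣ ≡ ∑[ i < n ] indicator (lookup p i)
∣p∣≡∑indicator []      = refl
∣p∣≡∑indicator (b ∷ p) = trans (∣∷∣ b p) (cong (indicator b +_) (∣p∣≡∑indicator p))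

∣p∣≡0⇒p≡⊥ : ∀ {m} (p : Subset m) → ∣ p ∣ ≡ 0 → p ≡ ⊥
∣p∣≡0⇒p≡⊥ []          _     = refl
∣p∣≡0⇒p≡⊥ (false ∷ p) ∣p∣≡0 = cong (false ∷_) (∣p∣≡0⇒p≡⊥ p ∣p∣≡0)

p≢⊥⇒0<∣p∣ : ∀ {m} (p : Subset m) → p ≢ ⊥ → 0 < ∣ p ∣
p≢⊥⇒0<∣p∣ p p≢⊥ = n≢0⇒n>0 (p≢⊥ ∘ ∣p∣≡0⇒p≡⊥ p)

totalWeight : ∀ {m} → List (Subset m) → ℕ
totalWeight ps = sum (map ∣_∣ ps)

length≤totalWeight : ∀ {m} (ps : List (Subset m)) → All (⊥ ≢_) ps → length ps ≤ totalWeight ps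
length≤totalWeight []       []           = z≤n
length≤totalWeight (p ∷ ps) (⊥≢p ∷ ⊥∉ps) =
  +-mono-≤ (p≢⊥⇒0<∣p∣ p (⊥≢p ∘ sym)) (length≤totalWeight ps ⊥∉ps)

length≤totalWeight+1 : ∀ {m} (ps : List (Subset m)) → Unique ps → length ps ≤ totalWeight ps + 1
length≤totalWeight+1     []       []              = z≤n
length≤totalWeight+1 {m} (p ∷ ps) (p∉ps ∷ unique) with ≡-dec Bool._≟_ p ⊥
... | yes refl = begin
  suc (length ps)                ≤⟨ s≤s (length≤totalWeight ps p∉ps) ⟩
  suc (totalWeight ps)           ≡⟨ +-comm 1 (totalWeight ps) ⟩
  totalWeight ps + 1             ≡⟨ cong (λ w → w + totalWeight ps + 1) (∣⊥∣≡0 m) ⟨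
  ∣ ⊥ {m} ∣ + totalWeight ps + 1 ∎
  where open ≤-Reasoning
... | no p≢⊥ = begin
  1 + length ps                  ≤⟨ +-mono-≤ (p≢⊥⇒0<∣p∣ p p≢⊥) (length≤totalWeight+1 ps unique) ⟩
  ∣ p ∣ + (totalWeight ps + 1)   ≡⟨ +-assoc ∣ p ∣ (totalWeight ps) 1 ⟨
  ∣ p ∣ + totalWeight ps + 1     ∎
  where open ≤-Reasoning

tailsWithHead : ∀ {m} → Bool → List (Subset (suc m)) → List (Subset m)
tailsWithHead b []             = []
tailsWithHead b ((c ∷ p) ∷ ps) with b Bool.≟ c
... | yes _ = p ∷ tailsWithHead b ps
... | no  _ = tailsWithHead b ps

All-tailsWithHead : ∀ {m} b {p : Subset m} (ps : List (Subset (suc m))) →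
  All ((b ∷ p) ≢_) ps → All (p ≢_) (tailsWithHead b ps)
All-tailsWithHead b []             []              = []
All-tailsWithHead b ((c ∷ q) ∷ ps) (bp≢cq ∷ bp∉ps) with b Bool.≟ c
... | yes refl = (bp≢cq ∘ cong (b ∷_)) ∷ All-tailsWithHead b ps bp∉ps
... | no  _    = All-tailsWithHead b ps bp∉ps

Unique-tailsWithHead : ∀ {m} b (ps : List (Subset (suc m))) → Unique ps → Unique (tailsWithHead b ps)
Unique-tailsWithHead b []             []              = []
Unique-tailsWithHead b ((c ∷ p) ∷ ps) (cp∉ps ∷ unique) with b Bool.≟ c
... | yes refl = All-tailsWithHead b ps cp∉ps ∷ Unique-tailsWithHead b ps unique
... | no  _    = Unique-tailsWithHead b ps unique

length-tailsWithHead : ∀ {m} (ps : List (Subset (suc m))) →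
  length ps ≡ length (tailsWithHead false ps) + length (tailsWithHead true ps)
length-tailsWithHead []                 = refl
length-tailsWithHead ((false ∷ p) ∷ ps) = cong suc (length-tailsWithHead ps)
length-tailsWithHead ((true  ∷ p) ∷ ps) =
  trans (cong suc (length-tailsWithHead ps)) (sym (+-suc _ _))

totalWeight-tailsWithHead : ∀ {m} (ps : List (Subset (suc m))) →
  totalWeight ps ≡ totalWeight (tailsWithHead false ps)
                   + (length (tailsWithHead true ps) + totalWeight (tailsWithHead true ps))
totalWeight-tailsWithHead []                 = refl
totalWeight-tailsWithHead ((false ∷ p) ∷ ps) =
  trans (cong (∣ p ∣ +_) (totalWeight-tailsWithHead ps)) (sym (+-assoc ∣ p ∣ _ _))
totalWeight-tailsWithHead {m} ((true ∷ p) ∷ ps) =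
  trans (cong (λ w → suc (∣ p ∣ + w)) (totalWeight-tailsWithHead ps))
        (shuffle ∣ p ∣ (totalWeight ps₀) (length ps₁) (totalWeight ps₁))
  where
  ps₀ ps₁ : List (Subset m)
  ps₀ = tailsWithHead false ps
  ps₁ = tailsWithHead true ps
  shuffle : ∀ a b c d → suc (a + (b + (c + d))) ≡ b + (suc c + (a + d))
  shuffle = solve-∀

Unique⇒length≤1 : (ps : List (Subset 0)) → Unique ps → length ps ≤ 1
Unique⇒length≤1 []            _                = z≤n
Unique⇒length≤1 (_ ∷ [])      _                = s≤s z≤n
Unique⇒length≤1 ([] ∷ [] ∷ _) ((≢[] ∷ _) ∷ _) = contradiction refl ≢[]

-- Split by the first letter: the tails of the words starting with 0 are handled inductively,
-- and among the words starting with 1 at most one has no further 1.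
2*length≤totalWeight+m+2 : ∀ m (ps : List (Subset m)) → Unique ps →
  2 * length ps ≤ totalWeight ps + m + 2
2*length≤totalWeight+m+2 zero ps unique = begin
  2 * length ps                  ≤⟨ *-monoʳ-≤ 2 (Unique⇒length≤1 ps unique) ⟩
  2                              ≤⟨ m≤n+m 2 (totalWeight ps + 0) ⟩
  totalWeight ps + 0 + 2         ∎
  where open ≤-Reasoning
2*length≤totalWeight+m+2 (suc m) ps unique = begin
  2 * length ps                  ≡⟨ cong (2 *_) (length-tailsWithHead ps) ⟩
  2 * (length ps₀ + length ps₁)  ≡⟨ regroup (length ps₀) (length ps₁) ⟩
  2 * length ps₀ + (length ps₁ + length ps₁)
    ≤⟨ +-mono-≤ (2*length≤totalWeight+m+2 m ps₀ (Unique-tailsWithHead false ps unique))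
                (+-monoʳ-≤ (length ps₁) (length≤totalWeight+1 ps₁ (Unique-tailsWithHead true ps unique))) ⟩
  (totalWeight ps₀ + m + 2) + (length ps₁ + (totalWeight ps₁ + 1))
    ≡⟨ collect (totalWeight ps₀) m (length ps₁) (totalWeight ps₁) ⟩
  totalWeight ps₀ + (length ps₁ + totalWeight ps₁) + suc m + 2
    ≡⟨ cong (λ w → w + suc m + 2) (totalWeight-tailsWithHead ps) ⟨
  totalWeight ps + suc m + 2     ∎
  where
  open ≤-Reasoning
  ps₀ ps₁ : List (Subset m)
  ps₀ = tailsWithHead false ps
  ps₁ = tailsWithHead true ps
  regroup : ∀ a b → 2 * (a + b) ≡ 2 * a + (b + b)
  regroup = solve-∀
  collect : ∀ a b c d → (a + b + 2) + (c + (d + 1)) ≡ a + (c + d) + suc b + 2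
  collect = solve-∀

permute : ∀ {n} → Permutation′ n → Subset n → Subset n
permute π p = Vec.tabulate (λ i → lookup p (π ⟨$⟩ʳ i))

lookup-permute : ∀ {n} (π : Permutation′ n) (p : Subset n) i → lookup (permute π p) i ≡ lookup p (π ⟨$⟩ʳ i)
lookup-permute π p = lookup∘tabulate (λ i → lookup p (π ⟨$⟩ʳ i))

∣permute∣ : ∀ {n} (π : Permutation′ n) (p : Subset n) → ∣ permute π p ∣ ≡ ∣ p ∣
∣permute∣ {n} π p = begin
  ∣ permute π p ∣                               ≡⟨ ∣p∣≡∑indicator (permute π p) ⟩
  ∑[ i < n ] indicator (lookup (permute π p) i) ≡⟨ sum-cong-≗ (cong indicator ∘ lookup-permute π p) ⟩
  ∑[ i < n ] indicator (lookup p (π ⟨$⟩ʳ i))    ≡⟨ sum-permute (indicator ∘ lookup p) π ⟨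
  ∑[ i < n ] indicator (lookup p i)             ≡⟨ ∣p∣≡∑indicator p ⟨
  ∣ p ∣                                         ∎
  where open ≡-Reasoning

permute-flip : ∀ {n} (π : Permutation′ n) (p : Subset n) → permute (flip π) (permute π p) ≡ p
permute-flip π p = trans
  (tabulate-cong (λ i → trans (lookup-permute π p _) (cong (lookup p) (inverseʳ π))))
  (tabulate∘lookup p)

∈-permute⁻ : ∀ {n} (π : Permutation′ n) {p : Subset n} {i} → i ∈ permute π p → π ⟨$⟩ʳ i ∈ p
∈-permute⁻ π {p} {i} i∈ = lookup⇒[]= _ p (trans (sym (lookup-permute π p i)) ([]=⇒lookup i∈))

permute-preserves-Empty-∩ : ∀ {n} (π : Permutation′ n) {p q : Subset n} →
  Empty (p ∩ q) → Empty (permute π p ∩ permute π q)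
permute-preserves-Empty-∩ π {p} {q} p∩q≡∅ (i , i∈) with x∈p∩q⁻ (permute π p) (permute π q) i∈
... | i∈p , i∈q = p∩q≡∅ (π ⟨$⟩ʳ i , x∈p∩q⁺ (∈-permute⁻ π i∈p , ∈-permute⁻ π i∈q))

permuteVertex : ∀ {n k} → Permutation′ n → KVertex n k → KVertex n k
permuteVertex π (p , ∣p∣≡k) = permute π p , trans (∣permute∣ π p) ∣p∣≡k

permutationAut : ∀ {n k} → Permutation′ n → KAut n k
permutationAut π = record
  { to      = permuteVertex π
  ; from    = permuteVertex (flip π)
  ; to-from = λ v → permute-flip (flip π) (proj₁ v)
  ; from-to = λ v → permute-flip π (proj₁ v)
  ; adj     = λ u v → mk⇔ (permute-preserves-Empty-∩ π)
      (subst₂ (λ p q → Empty (p ∩ q)) (permute-flip π (proj₁ u)) (permute-flip π (proj₁ v))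
        ∘ permute-preserves-Empty-∩ (flip π))
  }

transpose-sends-i-to-j : ∀ {n} (i j : Fin n) → transpose i j ⟨$⟩ʳ i ≡ j
transpose-sends-i-to-j i j with i ≟ i
... | yes _   = refl
... | no  i≢i = contradiction refl i≢i

transpose-fixes-others : ∀ {n} {i j x : Fin n} → x ≢ i → x ≢ j → transpose i j ⟨$⟩ʳ x ≡ x
transpose-fixes-others {i = i} {j} {x} x≢i x≢j with x ≟ i
... | yes x≡i = contradiction x≡i x≢i
... | no  _ with x ≟ j
...   | yes x≡j = contradiction x≡j x≢j
...   | no  _   = refl

permute-transpose : ∀ {n} (p : Subset n) {i j} → lookup p i ≡ lookup p j → permute (transpose i j) p ≡ p
permute-transpose p {i} {j} pi≡pj = trans (tabulate-cong same-lookup) (tabulate∘lookup p)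
  where
  same-lookup : ∀ x → lookup p (transpose i j ⟨$⟩ʳ x) ≡ lookup p x
  same-lookup x with x ≟ i
  ... | yes refl = sym pi≡pj
  ... | no  _ with x ≟ j
  ...   | yes refl = pi≡pj
  ...   | no  _    = refl

someVertex : ∀ {n k} → k ≤ n → KVertex n k
someVertex {n}     {zero}  z≤n       = ⊥ , ∣⊥∣≡0 n
someVertex {suc n} {suc k} (s≤s k≤n) with someVertex k≤n
... | p , ∣p∣≡k = true ∷ p , cong suc ∣p∣≡k

∃-outside : ∀ {n} (p : Subset n) → ∣ p ∣ < n → ∃ λ z → lookup p z ≡ false
∃-outside (false ∷ p) _           = zero , refl
∃-outside (true  ∷ p) (s≤s ∣p∣<n) with ∃-outside p ∣p∣<n
... | z , pz≡false = suc z , pz≡false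

∃-inside : ∀ {n} (p : Subset n) → 0 < ∣ p ∣ → ∃ λ z → lookup p z ≡ true
∃-inside (true  ∷ p) _     = zero , refl
∃-inside (false ∷ p) 0<∣p∣ with ∃-inside p 0<∣p∣
... | z , pz≡true = suc z , pz≡true

∃-lookup≢ : ∀ {n} (p : Subset n) → 0 < ∣ p ∣ → ∣ p ∣ < n → ∀ i → ∃ λ z → lookup p z ≢ lookup p i
∃-lookup≢ p 0<∣p∣ ∣p∣<n i with lookup p i
... | true  with ∃-outside p ∣p∣<n
...   | z , pz≡false = z , λ pz≡true → contradiction (trans (sym pz≡false) pz≡true) λ ()
∃-lookup≢ p 0<∣p∣ ∣p∣<n i | false with ∃-inside p 0<∣p∣
...   | z , pz≡true = z , λ pz≡false → contradiction (trans (sym pz≡true) pz≡false) λ ()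

separatingVertex : ∀ {n k} → 0 < k → k < n → {i j : Fin n} → i ≢ j →
  Σ (KVertex n k) λ v → lookup (proj₁ v) i ≢ lookup (proj₁ v) j
separatingVertex {n} {k} 0<k k<n {i} {j} i≢j with someVertex (<⇒≤ k<n)
... | v@(p , ∣p∣≡k) with lookup p i Bool.≟ lookup p j
...   | no  pi≢pj = v , pi≢pj
...   | yes pi≡pj with ∃-lookup≢ p (subst (0 <_) (sym ∣p∣≡k) 0<k) (subst (_< n) (sym ∣p∣≡k) k<n) i
...     | z , pz≢pi = permuteVertex (transpose i z) v , separates
  where
  j≢z : j ≢ z
  j≢z refl = pz≢pi (sym pi≡pj)
  separates : lookup (permute (transpose i z) p) i ≢ lookup (permute (transpose i z) p) j
  separates eq = pz≢pi (begin
    lookup p z                                ≡⟨ cong (lookup p) (transpose-sends-i-to-j i z) ⟨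
    lookup p (transpose i z ⟨$⟩ʳ i)           ≡⟨ lookup-permute (transpose i z) p i ⟨
    lookup (permute (transpose i z) p) i      ≡⟨ eq ⟩
    lookup (permute (transpose i z) p) j      ≡⟨ lookup-permute (transpose i z) p j ⟩
    lookup p (transpose i z ⟨$⟩ʳ j)           ≡⟨ cong (lookup p) (transpose-fixes-others (i≢j ∘ sym) j≢z) ⟩
    lookup p j                                ≡⟨ pi≡pj ⟨
    lookup p i                                ∎)
    where open ≡-Reasoning

column : ∀ {n k} (S : List (KVertex n k)) → Fin n → Subset (length S)
column []      x = []
column (v ∷ S) x = lookup (proj₁ v) x ∷ column S x

column-≡⇒lookup-≡ : ∀ {n k} (S : List (KVertex n k)) {i j} → column S i ≡ column S j →
  ∀ {v} → v ∈ₗ S → lookup (proj₁ v) i ≡ lookup (proj₁ v) j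
column-≡⇒lookup-≡ (w ∷ S) eq (here refl) = ∷-injectiveˡ eq
column-≡⇒lookup-≡ (w ∷ S) eq (there v∈S) = column-≡⇒lookup-≡ S (∷-injectiveʳ eq) v∈S

column-injective : ∀ {n k} → 0 < k → k < n → (S : List (KVertex n k)) → Determining S →
  ∀ {i j} → column S i ≡ column S j → i ≡ j
column-injective 0<k k<n S determining {i} {j} eq with i ≟ j
... | yes i≡j = i≡j
... | no  i≢j with separatingVertex 0<k k<n i≢j
...   | v@(p , _) , pi≢pj = contradiction (begin
  lookup p i                                ≡⟨ cong (λ q → lookup q i) τ-fixes-p ⟨
  lookup (permute (transpose i j) p) i      ≡⟨ lookup-permute (transpose i j) p i ⟩
  lookup p (transpose i j ⟨$⟩ʳ i)           ≡⟨ cong (lookup p) (transpose-sends-i-to-j i j) ⟩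
  lookup p j                                ∎) pi≢pj
  where
  open ≡-Reasoning
  τ-fixes-p : permute (transpose i j) p ≡ p
  τ-fixes-p = determining (permutationAut (transpose i j))
    (λ w w∈S → permute-transpose (proj₁ w) (column-≡⇒lookup-≡ S eq w∈S)) v

totalWeight-tabulate : ∀ {n m} (f : Fin n → Subset m) → totalWeight (tabulate f) ≡ ∑[ x < n ] ∣ f x ∣
totalWeight-tabulate {zero}  f = refl
totalWeight-tabulate {suc n} f = cong (∣ f zero ∣ +_) (totalWeight-tabulate (f ∘ suc))

∑∣column∣ : ∀ {n k} (S : List (KVertex n k)) → ∑[ x < n ] ∣ column S x ∣ ≡ length S * k
∑∣column∣ {n}     []                = sum-replicate-zero n
∑∣column∣ {n} {k} ((p , ∣p∣≡k) ∷ S) = begin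
  ∑[ x < n ] ∣ lookup p x ∷ column S x ∣
    ≡⟨ sum-cong-≗ (λ x → ∣∷∣ (lookup p x) (column S x)) ⟩
  ∑[ x < n ] (indicator (lookup p x) + ∣ column S x ∣)
    ≡⟨ ∑-distrib-+ (indicator ∘ lookup p) (∣_∣ ∘ column S) ⟩
  ∑[ x < n ] indicator (lookup p x) + ∑[ x < n ] ∣ column S x ∣
    ≡⟨ cong₂ _+_ (trans (sym (∣p∣≡∑indicator p)) ∣p∣≡k) (∑∣column∣ S) ⟩
  k + length S * k
    ∎
  where open ≡-Reasoning

mainTheorem9 : (n k : ℕ) → 1 ≤ k → 2 * k < n →
    (S : List (KVertex n k)) → Determining S →
    2 * n ∸ 2 ≤ (k + 1) * length S
mainTheorem9 n k 0<k 2k<n S determining = begin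
  2 * n ∸ 2                                ≡⟨ cong (λ l → 2 * l ∸ 2) (length-tabulate (column S)) ⟨
  2 * length columns ∸ 2                   ≤⟨ ∸-monoˡ-≤ 2 (2*length≤totalWeight+m+2 m columns distinct) ⟩
  totalWeight columns + m + 2 ∸ 2          ≡⟨ m+n∸n≡m (totalWeight columns + m) 2 ⟩
  totalWeight columns + m                  ≡⟨ cong (_+ m) (trans (totalWeight-tabulate (column S)) (∑∣column∣ S)) ⟩
  m * k + m                                ≡⟨ rearrange m k ⟩
  (k + 1) * m                              ∎
  where
  open ≤-Reasoning
  m : ℕ
  m = length S
  columns : List (Subset m)
  columns = tabulate (column S)
  distinct : Unique columns
  distinct = tabulate⁺ (column-injective 0<k (≤-<-trans (m≤m+n k (k + 0)) 2k<n) S determining)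
  rearrange : ∀ m k → m * k + m ≡ (k + 1) * m
  rearrange = solve-∀
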